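{- Let $(\mathcal{T}_r)_{r\in\mathbb{Z}}$ be a sequence of complex numbers satisfying $\mathcal{T}_r=\mathcal{T}_{r-1}+\mathcal{T}_{r-2}+\mathcal{T}_{r-3}$ for all integers $r$. Then for every integer $r$: \[ \mathcal{T}_r^2 - 2\mathcal{T}_{r-1}^2 - 3\mathcal{T}_{r-2}^2 - 6\mathcal{T}_{r-3}^2 + \mathcal{T}_{r-4}^2 + \mathcal{T}_{r-6}^2 = 0, \] \[ \mathcal{T}_{r+2}^2 - 4\mathcal{T}_{r+1}^2 + \mathcal{T}_r^2 + 14\mathcal{T}_{r-2}^2 - 4\mathcal{T}_{r-3}^2 - 2\mathcal{T}_{r-4}^2 - 8\mathcal{T}_{r-5}^2 + \mathcal{T}_{r-6}^2 + \mathcal{T}_{r-8}^2 = 0, \] \[ \mathcal{T}_{r+3}^2 - 3\mathcal{T}_{r+2}^2 - 4\mathcal{T}_r^2 + 2\mathcal{T}_{r-1}^2 - 10\mathcal{T}_{r-2}^2 - 4\mathcal{T}_{r-3}^2 + \mathcal{T}_{r-5}^2 + \mathcal{T}_{r-6}^2 = 0, \] \[ \mathcal{T}_{r+1}^2 - 4\mathcal{T}_r^2 + 2\mathcal{T}_{r-2}^2 + 16\mathcal{T}_{r-3}^2 + 4\mathcal{T}_{r-4}^2 - 2\mathcal{T}_{r-6}^2 - \mathcal{T}_{r-7}^2 = 0, \] \[ \mathcal{T}_{r+2}^2 - 2\mathcal{T}_{r+1}^2 - 2\mathcal{T}_r^2 - 8\mathcal{T}_{r-1}^2 - 2\mathcal{T}_{r-2}^2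 - 6\mathcal{T}_{r-3}^2 + 2\mathcal{T}_{r-4}^2 + \mathcal{T}_{r-6}^2 = 0. \]
   Context: A generalized Tribonacci sequence is determined by arbitrary initial values $\mathcal{T}_0,\mathcal{T}_1,\mathcal{T}_2$ and the recurrence $\mathcal{T}_r=\mathcal{T}_{r-1}+\mathcal{T}_{r-2}+\mathcal{T}_{r-3}$, extended to all integer indices (equivalently, the recurrence holds for all $r\in\mathbb{Z}$). -}

module Defs where

open import Algebra.Bundles using (CommutativeRing)
open import Data.Nat using (ℕ; zero; suc)
open import Data.Integer as ℤ using (ℤ; +_)

module _ {c ℓ} (R : CommutativeRing c ℓ) where
  open CommutativeRing R

  infixr 8 _·_
  _·_ : ℕ → Carrier → Carrier
  zero  · x = 0#
  suc n · x = x + n · x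

  sq : Carrier → Carrier
  sq x = x * x

  IsTribonacci : (ℤ → Carrier) → Set ℓ
  IsTribonacci T = ∀ (r : ℤ) → T r ≈ T (r ℤ.- + 1) + T (r ℤ.- + 2) + T (r ℤ.- + 3)

-- Going forward, every term of a Tribonacci sequence is a combination with
-- natural-number coefficients of any three consecutive earlier terms. Expressing
-- T (r - 7), ..., T (r + 3) through T (r - 8), T (r - 7), T (r - 6) turns each identity
-- into a polynomial identity in three variables, which the ring solver decides.
-- That solver works with ℕ coefficients, i.e. in commutative semirings, so each
-- identity is checked in the subtraction-free form
-- "sum of the positive terms = sum of the negative terms".

module Submission where

open import Defs
open import Algebra.Bundles using (CommutativeRing; Semiring; RawSemiring)
open import Data.Integer as ℤ using (ℤ; +_; -[1+_])
import Data.Integer.Properties as ℤ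
open import Data.List using (List; []; _∷_)
open import Data.Nat using (ℕ; zero; suc)
open import Data.Product using (_×_; _,_)
open import Data.Vec using (Vec; []; _∷_)
open import Level using (0ℓ)
import Data.Fin as Fin
open import Relation.Binary.PropositionalEquality as ≡ using (_≡_)

-- Signed sums of weighted squares ± k · u(i)² are kept as syntax: value below
-- reproduces the left-nested expression literally, while positives and
-- negatives give the two sides of its subtraction-free form.

infix  7 sq⟨_⟩ _·sq⟨_⟩
infix  6 ⊕_ ⊖_

data Monomial : Set where
  sq⟨_⟩   : ℕ → Monomial
  _·sq⟨_⟩ : ℕ → ℕ → Monomial

data Term : Set where
  ⊕_ ⊖_ : Monomial → Term

SquareSum : Set
SquareSum = Monomial × List Term

-- r ⊕ o is r ℤ.+ o, except that it is r itself when o = 0; then the indices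
-- r ⊕ (+ k ℤ.- + 8) compute to exactly the index expressions r, r ℤ.+ + j, r ℤ.- + j.
infixl 6 _⊕_
_⊕_ : ℤ → ℤ → ℤ
r ⊕ + zero    = r
r ⊕ + suc n   = r ℤ.+ + suc n
r ⊕ -[1+ n ] = r ℤ.+ -[1+ n ]

⊕≡+ : ∀ r o → r ⊕ o ≡ r ℤ.+ o
⊕≡+ r (+ zero)   = ≡.sym (ℤ.+-identityʳ r)
⊕≡+ r (+ suc n)  = ≡.refl
⊕≡+ r -[1+ n ]  = ≡.refl

⊕-rebase : ∀ r i j → r ⊕ (i ℤ.- j) ≡ r ℤ.- j ℤ.+ i
⊕-rebase r i j = begin
  r ⊕ (i ℤ.- j)      ≡⟨ ⊕≡+ r (i ℤ.- j) ⟩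
  r ℤ.+ (i ℤ.- j)    ≡⟨ ≡.cong (λ o → r ℤ.+ o) (ℤ.+-comm i (ℤ.- j)) ⟩
  r ℤ.+ (ℤ.- j ℤ.+ i) ≡⟨ ℤ.+-assoc r (ℤ.- j) i ⟨
  r ℤ.- j ℤ.+ i      ∎
  where open ≡.≡-Reasoning

module _ {a ℓ} (A : RawSemiring a ℓ) where
  open RawSemiring A
  open import Algebra.Definitions.RawSemiring A renaming (_×_ to _·ₙ_)

  monomial : (ℕ → Carrier) → Monomial → Carrier
  monomial u sq⟨ i ⟩     = u i * u i
  monomial u (k ·sq⟨ i ⟩) = k ·ₙ (u i * u i)

  plus minus : (ℕ → Carrier) → List Term → Carrier
  plus u []         = 0#
  plus u (⊕ m ∷ ts) = monomial u m + plus u ts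
  plus u (⊖ m ∷ ts) = plus u ts
  minus u []         = 0#
  minus u (⊕ m ∷ ts) = minus u ts
  minus u (⊖ m ∷ ts) = monomial u m + minus u ts

  positives negatives : (ℕ → Carrier) → SquareSum → Carrier
  positives u (m , ts) = monomial u m + plus u ts
  negatives u (m , ts) = minus u ts

module _ {c ℓ} (R : CommutativeRing c ℓ) where
  open CommutativeRing R
  open import Relation.Binary.Reasoning.Setoid setoid
  open import Algebra.Properties.Group +-group using (identityˡ-unique; //-rightDividesˡ)
  open import Algebra.Properties.CommutativeSemigroup +-commutativeSemigroup using (xy∙z≈xz∙y)
  open import Algebra.Properties.Monoid.Mult +-monoid using (×-congʳ)

  ℛ : RawSemiring c ℓ
  ℛ = Semiring.rawSemiring semiring

  valueFrom : (ℕ → Carrier) → Carrier → List Term → Carrier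
  valueFrom u acc []         = acc
  valueFrom u acc (⊕ m ∷ ts) = valueFrom u (acc + monomial ℛ u m) ts
  valueFrom u acc (⊖ m ∷ ts) = valueFrom u (acc - monomial ℛ u m) ts

  value : (ℕ → Carrier) → SquareSum → Carrier
  value u (m , ts) = valueFrom u (monomial ℛ u m) ts

  monomial-cong : ∀ {u v} → (∀ i → u i ≈ v i) → ∀ m → monomial ℛ u m ≈ monomial ℛ v m
  monomial-cong u≈v sq⟨ i ⟩       = *-cong (u≈v i) (u≈v i)
  monomial-cong u≈v (k ·sq⟨ i ⟩) = ×-congʳ k (*-cong (u≈v i) (u≈v i))

  valueFrom-cong : ∀ {u v acc acc′} → (∀ i → u i ≈ v i) → acc ≈ acc′ →
                   ∀ ts → valueFrom u acc ts ≈ valueFrom v acc′ ts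
  valueFrom-cong u≈v acc≈acc′ []         = acc≈acc′
  valueFrom-cong u≈v acc≈acc′ (⊕ m ∷ ts) =
    valueFrom-cong u≈v (+-cong acc≈acc′ (monomial-cong u≈v m)) ts
  valueFrom-cong u≈v acc≈acc′ (⊖ m ∷ ts) =
    valueFrom-cong u≈v (+-cong acc≈acc′ (-‿cong (monomial-cong u≈v m))) ts

  value-cong : ∀ {u v} → (∀ i → u i ≈ v i) → ∀ f → value u f ≈ value v f
  value-cong u≈v (m , ts) = valueFrom-cong u≈v (monomial-cong u≈v m) ts

  valueFrom+minus≈plus : ∀ u acc ts → valueFrom u acc ts + minus ℛ u ts ≈ acc + plus ℛ u ts
  valueFrom+minus≈plus u acc [] = refl
  valueFrom+minus≈plus u acc (⊕ m ∷ ts) = begin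
    valueFrom u (acc + x) ts + minus ℛ u ts ≈⟨ valueFrom+minus≈plus u (acc + x) ts ⟩
    acc + x + plus ℛ u ts                    ≈⟨ +-assoc acc x _ ⟩
    acc + (x + plus ℛ u ts)                  ∎
    where x = monomial ℛ u m
  valueFrom+minus≈plus u acc (⊖ m ∷ ts) = begin
    valueFrom u (acc - x) ts + (x + minus ℛ u ts) ≈⟨ +-congˡ (+-comm x _) ⟩
    valueFrom u (acc - x) ts + (minus ℛ u ts + x) ≈⟨ +-assoc _ _ x ⟨
    valueFrom u (acc - x) ts + minus ℛ u ts + x   ≈⟨ +-congʳ (valueFrom+minus≈plus u (acc - x) ts) ⟩
    acc - x + plus ℛ u ts + x                     ≈⟨ +-congʳ (xy∙z≈xz∙y acc (- x) _) ⟩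
    acc + plus ℛ u ts - x + x                     ≈⟨ //-rightDividesˡ x _ ⟩
    acc + plus ℛ u ts                             ∎
    where x = monomial ℛ u m

  value≈0 : ∀ u f → positives ℛ u f ≈ negatives ℛ u f → value u f ≈ 0#
  value≈0 u f@(m , ts) balanced = identityˡ-unique (value u f) (negatives ℛ u f) (begin
    value u f + minus ℛ u ts ≈⟨ valueFrom+minus≈plus u (monomial ℛ u m) ts ⟩
    positives ℛ u f          ≈⟨ balanced ⟩
    negatives ℛ u f          ∎)

  open import Algebra.Solver.Ring.NaturalCoefficients.Default commutativeSemiring
    using (Polynomial; _:+_; _:*_; con; var; ⟦_⟧; ⟦_⟧↓; prove)

  𝒫 : RawSemiring 0ℓ 0ℓ
  𝒫 = record
    { Carrier = Polynomial 3
    ; _≈_     = _≡_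
    ; _+_     = _:+_
    ; _*_     = _:*_
    ; 0#      = con 0
    ; 1#      = con 1
    }

  basis : ℕ → Polynomial 3
  basis 0 = var Fin.zero
  basis 1 = var (Fin.suc Fin.zero)
  basis 2 = var (Fin.suc (Fin.suc Fin.zero))
  basis (suc (suc (suc k))) = basis (suc (suc k)) :+ basis (suc k) :+ basis k

  module _ (ρ : Vec Carrier 3) where
    ⟦monomial⟧ : ∀ m → ⟦ monomial 𝒫 basis m ⟧ ρ ≈ monomial ℛ (λ i → ⟦ basis i ⟧ ρ) m
    ⟦monomial⟧ sq⟨ i ⟩ = refl
    ⟦monomial⟧ (zero  ·sq⟨ i ⟩) = refl
    ⟦monomial⟧ (suc k ·sq⟨ i ⟩) = +-congˡ (⟦monomial⟧ (k ·sq⟨ i ⟩))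

    ⟦plus⟧ : ∀ ts → ⟦ plus 𝒫 basis ts ⟧ ρ ≈ plus ℛ (λ i → ⟦ basis i ⟧ ρ) ts
    ⟦plus⟧ []         = refl
    ⟦plus⟧ (⊕ m ∷ ts) = +-cong (⟦monomial⟧ m) (⟦plus⟧ ts)
    ⟦plus⟧ (⊖ m ∷ ts) = ⟦plus⟧ ts

    ⟦minus⟧ : ∀ ts → ⟦ minus 𝒫 basis ts ⟧ ρ ≈ minus ℛ (λ i → ⟦ basis i ⟧ ρ) ts
    ⟦minus⟧ []         = refl
    ⟦minus⟧ (⊕ m ∷ ts) = ⟦minus⟧ ts
    ⟦minus⟧ (⊖ m ∷ ts) = +-cong (⟦monomial⟧ m) (⟦minus⟧ ts)

    basis-value≈0 : ∀ f → ⟦ positives 𝒫 basis f ⟧↓ ρ ≈ ⟦ negatives 𝒫 basis f ⟧↓ ρ →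
                        value (λ i → ⟦ basis i ⟧ ρ) f ≈ 0#
    basis-value≈0 f@(m , ts) normal-forms≈ = value≈0 _ f (begin
      monomial ℛ _ m + plus ℛ _ ts         ≈⟨ +-cong (⟦monomial⟧ m) (⟦plus⟧ ts) ⟨
      ⟦ positives 𝒫 basis f ⟧ ρ            ≈⟨ prove ρ (positives 𝒫 basis f) (negatives 𝒫 basis f) normal-forms≈ ⟩
      ⟦ negatives 𝒫 basis f ⟧ ρ            ≈⟨ ⟦minus⟧ ts ⟩
      minus ℛ _ ts                         ∎)

  IsTribonacciℕ : (ℕ → Carrier) → Set ℓ
  IsTribonacciℕ v = ∀ k → v (suc (suc (suc k))) ≈ v (suc (suc k)) + v (suc k) + v k

  isTribonacciℕ≈basis : ∀ {v} → IsTribonacciℕ v → ∀ k → v k ≈ ⟦ basis k ⟧ (v 0 ∷ v 1 ∷ v 2 ∷ [])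
  isTribonacciℕ≈basis tri 0 = refl
  isTribonacciℕ≈basis tri 1 = refl
  isTribonacciℕ≈basis tri 2 = refl
  isTribonacciℕ≈basis tri (suc (suc (suc k))) = trans (tri k)
    (+-cong (+-cong (isTribonacciℕ≈basis tri (suc (suc k))) (isTribonacciℕ≈basis tri (suc k)))
            (isTribonacciℕ≈basis tri k))

  isTribonacci⇒isTribonacciℕ : ∀ {T} → IsTribonacci R T → ∀ s → IsTribonacciℕ (λ k → T (s ℤ.+ + k))
  isTribonacci⇒isTribonacciℕ {T} tri s k =
    trans (tri (s ℤ.+ + suc (suc (suc k)))) (+-cong (+-cong (T-assoc _ _) (T-assoc _ _)) (T-assoc _ _))
    where
    T-assoc : ∀ i j → T (s ℤ.+ i ℤ.+ j) ≈ T (s ℤ.+ (i ℤ.+ j))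
    T-assoc i j = reflexive (≡.cong T (ℤ.+-assoc s i j))

  module TribonacciWindow {T} (tri : IsTribonacci R T) (r : ℤ) where
    window : ℕ → Carrier
    window k = T (r ⊕ (+ k ℤ.- + 8))

    private
      fromBase : ℕ → Carrier
      fromBase k = T (r ℤ.- + 8 ℤ.+ + k)

    ρ : Vec Carrier 3
    ρ = fromBase 0 ∷ fromBase 1 ∷ fromBase 2 ∷ []

    window≈basis : ∀ k → window k ≈ ⟦ basis k ⟧ ρ
    window≈basis k = trans (reflexive (≡.cong T (⊕-rebase r (+ k) (+ 8))))
                           (isTribonacciℕ≈basis (isTribonacci⇒isTribonacciℕ tri (r ℤ.- + 8)) k)

    window-value≈0 : ∀ f → ⟦ positives 𝒫 basis f ⟧↓ ρ ≈ ⟦ negatives 𝒫 basis f ⟧↓ ρ →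
                     value window f ≈ 0#
    window-value≈0 f normal-forms≈ =
      trans (value-cong window≈basis f) (basis-value≈0 ρ f normal-forms≈)

-- Position k stands for the term T (r - 8 + k).
form₁ form₂ form₃ form₄ form₅ : SquareSum
form₁ = sq⟨ 8 ⟩ , ⊖ 2 ·sq⟨ 7 ⟩ ∷ ⊖ 3 ·sq⟨ 6 ⟩ ∷ ⊖ 6 ·sq⟨ 5 ⟩ ∷ ⊕ sq⟨ 4 ⟩ ∷ ⊕ sq⟨ 2 ⟩ ∷ []
form₂ = sq⟨ 10 ⟩ , ⊖ 4 ·sq⟨ 9 ⟩ ∷ ⊕ sq⟨ 8 ⟩ ∷ ⊕ 14 ·sq⟨ 6 ⟩ ∷ ⊖ 4 ·sq⟨ 5 ⟩ ∷ ⊖ 2 ·sq⟨ 4 ⟩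
          ∷ ⊖ 8 ·sq⟨ 3 ⟩ ∷ ⊕ sq⟨ 2 ⟩ ∷ ⊕ sq⟨ 0 ⟩ ∷ []
form₃ = sq⟨ 11 ⟩ , ⊖ 3 ·sq⟨ 10 ⟩ ∷ ⊖ 4 ·sq⟨ 8 ⟩ ∷ ⊕ 2 ·sq⟨ 7 ⟩ ∷ ⊖ 10 ·sq⟨ 6 ⟩ ∷ ⊖ 4 ·sq⟨ 5 ⟩
          ∷ ⊕ sq⟨ 3 ⟩ ∷ ⊕ sq⟨ 2 ⟩ ∷ []
form₄ = sq⟨ 9 ⟩ , ⊖ 4 ·sq⟨ 8 ⟩ ∷ ⊕ 2 ·sq⟨ 6 ⟩ ∷ ⊕ 16 ·sq⟨ 5 ⟩ ∷ ⊕ 4 ·sq⟨ 4 ⟩ ∷ ⊖ 2 ·sq⟨ 2 ⟩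
          ∷ ⊖ sq⟨ 1 ⟩ ∷ []
form₅ = sq⟨ 10 ⟩ , ⊖ 2 ·sq⟨ 9 ⟩ ∷ ⊖ 2 ·sq⟨ 8 ⟩ ∷ ⊖ 8 ·sq⟨ 7 ⟩ ∷ ⊖ 2 ·sq⟨ 6 ⟩ ∷ ⊖ 6 ·sq⟨ 5 ⟩
          ∷ ⊕ 2 ·sq⟨ 4 ⟩ ∷ ⊕ sq⟨ 2 ⟩ ∷ []

theorem1 : ∀ {c ℓ} (R : CommutativeRing c ℓ) → let open CommutativeRing R in
    (T : ℤ → Carrier) → IsTribonacci R T → (r : ℤ) →
      (sq R (T r) - _·_ R 2 (sq R (T (r ℤ.- + 1))) - _·_ R 3 (sq R (T (r ℤ.- + 2))) - _·_ R 6 (sq R (T (r ℤ.- + 3))) + sq R (T (r ℤ.- + 4)) + sq R (T (r ℤ.- + 6)) ≈ 0#)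
      × (sq R (T (r ℤ.+ + 2)) - _·_ R 4 (sq R (T (r ℤ.+ + 1))) + sq R (T r) + _·_ R 14 (sq R (T (r ℤ.- + 2))) - _·_ R 4 (sq R (T (r ℤ.- + 3))) - _·_ R 2 (sq R (T (r ℤ.- + 4))) - _·_ R 8 (sq R (T (r ℤ.- + 5))) + sq R (T (r ℤ.- + 6)) + sq R (T (r ℤ.- + 8)) ≈ 0#)
      × (sq R (T (r ℤ.+ + 3)) - _·_ R 3 (sq R (T (r ℤ.+ + 2))) - _·_ R 4 (sq R (T r)) + _·_ R 2 (sq R (T (r ℤ.- + 1))) - _·_ R 10 (sq R (T (r ℤ.- + 2))) - _·_ R 4 (sq R (T (r ℤ.- + 3))) + sq R (T (r ℤ.- + 5)) + sq R (T (r ℤ.- + 6)) ≈ 0#)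
      × (sq R (T (r ℤ.+ + 1)) - _·_ R 4 (sq R (T r)) + _·_ R 2 (sq R (T (r ℤ.- + 2))) + _·_ R 16 (sq R (T (r ℤ.- + 3))) + _·_ R 4 (sq R (T (r ℤ.- + 4))) - _·_ R 2 (sq R (T (r ℤ.- + 6))) - sq R (T (r ℤ.- + 7)) ≈ 0#)
      × (sq R (T (r ℤ.+ + 2)) - _·_ R 2 (sq R (T (r ℤ.+ + 1))) - _·_ R 2 (sq R (T r)) - _·_ R 8 (sq R (T (r ℤ.- + 1))) - _·_ R 2 (sq R (T (r ℤ.- + 2))) - _·_ R 6 (sq R (T (r ℤ.- + 3))) + _·_ R 2 (sq R (T (r ℤ.- + 4))) + sq R (T (r ℤ.- + 6)) ≈ 0#)
theorem1 R T tri r =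
    window-value≈0 form₁ refl , window-value≈0 form₂ refl , window-value≈0 form₃ refl
  , window-value≈0 form₄ refl , window-value≈0 form₅ refl
  where
  open CommutativeRing R using (refl)
  open TribonacciWindow R tri r
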